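{- For every Boolean function $f:\{0,1\}^n\to\{0,1\}$, $\mathrm{C}_{\min}(f)\le \mathrm{Rank}(f)$. This is tight for $\mathrm{OR}_n$.
   Context: For $a\in\{0,1\}^n$, $\mathrm{C}(f,a)$ is the minimum size of $S\subseteq[n]$ such that every $a'$ agreeing with $a$ on $S$ has $f(a')=f(a)$; $\mathrm{C}_{\min}(f)=\min_a\mathrm{C}(f,a)$. A decision tree queries single variables and has $0/1$ leaves. Rank of a rooted binary tree: leaves have rank $0$; an internal node with children of ranks $a,b$ has rank $a+1$ if $a=b$, else $\max\{a,b\}$; $\mathrm{Rank}(f)$ is the minimum rank of a decision tree computing $f$. -}

module Defs where

open import Data.Nat using (ℕ; zero; suc; _⊔_)
open import Data.Bool using (Bool; true; false; if_then_else_; _∨_)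
open import Data.Fin using (Fin; zero; suc)
open import Data.Fin.Subset using (Subset; _∈_; ∣_∣)
open import Relation.Binary.PropositionalEquality using (_≡_)

Input : ℕ → Set
Input n = Fin n → Bool

BoolFun : ℕ → Set
BoolFun n = Input n → Bool

AgreeOn : {n : ℕ} → Subset n → Input n → Input n → Set
AgreeOn S a a' = ∀ i → i ∈ S → a' i ≡ a i

IsCertificate : {n : ℕ} → BoolFun n → Input n → Subset n → Set
IsCertificate f a S = ∀ a' → AgreeOn S a a' → f a' ≡ f a

data DTree (n : ℕ) : Set where
  leaf : Bool → DTree n
  node : Fin n → DTree n → DTree n → DTree n

eval : {n : ℕ} → DTree n → Input n → Bool
eval (leaf b) x = b
eval (node i t₀ t₁) x = if x i then eval t₁ x else eval t₀ x

Computes : {n : ℕ} → DTree n → BoolFun n → Set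
Computes T f = ∀ x → eval T x ≡ f x

-- rank of children ranks a, b: a+1 if a = b, else max a b
rankCombine : ℕ → ℕ → ℕ
rankCombine zero zero = suc zero
rankCombine zero (suc b) = suc b
rankCombine (suc a) zero = suc a
rankCombine (suc a) (suc b) = suc (rankCombine a b)

rank : {n : ℕ} → DTree n → ℕ
rank (leaf _) = zero
rank (node _ t₀ t₁) = rankCombine (rank t₀) (rank t₁)

OR : (n : ℕ) → BoolFun n
OR zero x = false
OR (suc n) x = x zero ∨ OR n (λ i → x (suc i))

{-# OPTIONS --safe #-}
module Submission where

-- Walk down from the root, always entering a child of strictly smaller rank (one exists
-- by the definition of rank), and fix each queried variable to the direction taken: this
-- certifies the leaf reached with at most rank T variables. A variable queried again is
-- already fixed and must be followed to whichever child it leads; that costs no new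
-- variable, and no child has larger rank than its parent. So the induction carries the
-- restriction fixed so far.
-- For OR_n, the tree querying the variables in turn has rank 1, while an empty
-- certificate would make OR_n constant.

open import Defs
open import Data.Bool using (Bool; true; false; if_then_else_)
open import Data.Empty using (⊥-elim)
open import Data.Fin using (Fin; zero; suc)
open import Data.Fin.Properties using (_≟_)
open import Data.Fin.Subset using (Subset; inside; outside; _∪_; ⁅_⁆; ∣_∣; ⊥; Nonempty)
open import Data.Fin.Subset.Properties
  using (∣p∣≤∣x∷p∣; ∣⊥∣≡0; ∣⁅x⁆∣≡1; x∈⁅x⁆; x∈p∪q⁺; nonempty?; x∈p⇒∣p-x∣<∣p∣)
open import Data.Maybe using (Maybe; just; nothing; fromMaybe)
open import Data.Maybe.Properties using (just-injective)
open import Data.Nat using (ℕ; zero; suc; _+_; _≤_; _<_; z≤n; s≤s)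
open import Data.Nat.Properties using (≤-refl; ≤-trans; ≤-reflexive; +-suc; +-monoʳ-≤)
open import Data.Product using (Σ; ∃-syntax; _×_; _,_)
open import Data.Sum using (_⊎_; inj₁; inj₂)
open import Data.Vec using ([]; _∷_)
open import Data.Vec.Functional using (updateAt)
open import Data.Vec.Functional.Properties using (updateAt-updates; updateAt-minimal)
open import Function using (_∘_; const)
open import Relation.Nullary using (yes; no)
open import Relation.Binary.PropositionalEquality
  using (_≡_; _≢_; _≗_; refl; sym; trans; cong; cong₂; subst; module ≡-Reasoning)

private
  variable
    m n : ℕ

∣p∪q∣≤∣p∣+∣q∣ : (p q : Subset n) → ∣ p ∪ q ∣ ≤ ∣ p ∣ + ∣ q ∣
∣p∪q∣≤∣p∣+∣q∣ []            []            = z≤n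
∣p∪q∣≤∣p∣+∣q∣ (inside  ∷ p) (x ∷ q)       =
  s≤s (≤-trans (∣p∪q∣≤∣p∣+∣q∣ p q) (+-monoʳ-≤ ∣ p ∣ (∣p∣≤∣x∷p∣ x q)))
∣p∪q∣≤∣p∣+∣q∣ (outside ∷ p) (inside  ∷ q) =
  ≤-trans (s≤s (∣p∪q∣≤∣p∣+∣q∣ p q)) (≤-reflexive (sym (+-suc ∣ p ∣ ∣ q ∣)))
∣p∪q∣≤∣p∣+∣q∣ (outside ∷ p) (outside ∷ q) = ∣p∪q∣≤∣p∣+∣q∣ p q

∣⁅x⁆∪p∣≤1+∣p∣ : ∀ (x : Fin n) p → ∣ ⁅ x ⁆ ∪ p ∣ ≤ suc ∣ p ∣
∣⁅x⁆∪p∣≤1+∣p∣ x p = subst (λ k → ∣ ⁅ x ⁆ ∪ p ∣ ≤ k + ∣ p ∣) (∣⁅x⁆∣≡1 x) (∣p∪q∣≤∣p∣+∣q∣ ⁅ x ⁆ p)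

rankCombine-≥ˡ : ∀ a b → a ≤ rankCombine a b
rankCombine-≥ˡ zero    b       = z≤n
rankCombine-≥ˡ (suc a) zero    = ≤-refl
rankCombine-≥ˡ (suc a) (suc b) = s≤s (rankCombine-≥ˡ a b)

rankCombine-≥ʳ : ∀ a b → b ≤ rankCombine a b
rankCombine-≥ʳ zero    zero    = z≤n
rankCombine-≥ʳ zero    (suc b) = ≤-refl
rankCombine-≥ʳ (suc a) zero    = z≤n
rankCombine-≥ʳ (suc a) (suc b) = s≤s (rankCombine-≥ʳ a b)

rankCombine->ˡ⊎>ʳ : ∀ a b → a < rankCombine a b ⊎ b < rankCombine a b
rankCombine->ˡ⊎>ʳ zero    zero    = inj₁ ≤-refl
rankCombine->ˡ⊎>ʳ zero    (suc b) = inj₁ (s≤s z≤n)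
rankCombine->ˡ⊎>ʳ (suc a) zero    = inj₂ (s≤s z≤n)
rankCombine->ˡ⊎>ʳ (suc a) (suc b) with rankCombine->ˡ⊎>ʳ a b
... | inj₁ a< = inj₁ (s≤s a<)
... | inj₂ b< = inj₂ (s≤s b<)

child : Bool → DTree n → DTree n → DTree n
child c t₀ t₁ = if c then t₁ else t₀

eval-node : ∀ {i c} (t₀ t₁ : DTree n) (x : Input n) →
            x i ≡ c → eval (node i t₀ t₁) x ≡ eval (child c t₀ t₁) x
eval-node {c = false} t₀ t₁ x xi≡c rewrite xi≡c = refl
eval-node {c = true}  t₀ t₁ x xi≡c rewrite xi≡c = refl

rank-child≤rank-node : ∀ c (i : Fin n) t₀ t₁ → rank (child c t₀ t₁) ≤ rank (node i t₀ t₁)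
rank-child≤rank-node false i t₀ t₁ = rankCombine-≥ˡ (rank t₀) (rank t₁)
rank-child≤rank-node true  i t₀ t₁ = rankCombine-≥ʳ (rank t₀) (rank t₁)

lowerRankChild : (i : Fin n) (t₀ t₁ : DTree n) → ∃[ c ] rank (child c t₀ t₁) < rank (node i t₀ t₁)
lowerRankChild i t₀ t₁ with rankCombine->ˡ⊎>ʳ (rank t₀) (rank t₁)
... | inj₁ r₀< = false , r₀<
... | inj₂ r₁< = true  , r₁<

Restriction : ℕ → Set
Restriction n = Fin n → Maybe Bool

Extends : Restriction n → Input n → Set
Extends ρ x = ∀ i {c} → ρ i ≡ just c → x i ≡ c

_[_↦_] : Restriction n → Fin n → Bool → Restriction n
ρ [ i ↦ c ] = updateAt ρ i (const (just c))

extends-fromMaybe : (ρ : Restriction n) → Extends ρ (fromMaybe false ∘ ρ)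
extends-fromMaybe ρ i ρi≡c = cong (fromMaybe false) ρi≡c

extends-↦⁺ : ∀ (ρ : Restriction n) i {c x} → Extends ρ x → x i ≡ c → Extends (ρ [ i ↦ c ]) x
extends-↦⁺ ρ i x⊒ρ xi≡c j with j ≟ i
... | yes refl = λ eq → trans xi≡c (just-injective (trans (sym (updateAt-updates i ρ)) eq))
... | no j≢i = λ eq → x⊒ρ j (trans (sym (updateAt-minimal j i ρ j≢i)) eq)

extends-↦⁻ : ∀ (ρ : Restriction n) i {c x} → ρ i ≡ nothing → Extends (ρ [ i ↦ c ]) x → Extends ρ x
extends-↦⁻ ρ i ρi≡nothing x⊒ρ′ j {d} ρj≡d with j ≟ i
... | yes refl with () ← trans (sym ρi≡nothing) ρj≡d
... | no j≢i = x⊒ρ′ j (trans (updateAt-minimal j i ρ j≢i) ρj≡d)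

record RankCertificate (ρ : Restriction n) (T : DTree n) : Set where
  field
    point     : Input n
    support   : Subset n
    extends   : Extends ρ point
    small     : ∣ support ∣ ≤ rank T
    certifies : ∀ x → Extends ρ x → AgreeOn support point x → eval T x ≡ eval T point

fixedQueryCertificate : ∀ (ρ : Restriction n) {i c} t₀ t₁ → ρ i ≡ just c →
                        RankCertificate ρ (child c t₀ t₁) → RankCertificate ρ (node i t₀ t₁)
fixedQueryCertificate ρ {i} {c} t₀ t₁ ρi≡c C = record
  { point = point ; support = support ; extends = extends
  ; small = ≤-trans small (rank-child≤rank-node c i t₀ t₁)
  ; certifies = λ x x⊒ρ x≈point → begin
      eval (node i t₀ t₁) x      ≡⟨ eval-node t₀ t₁ x (x⊒ρ i ρi≡c) ⟩
      eval (child c t₀ t₁) x     ≡⟨ certifies x x⊒ρ x≈point ⟩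
      eval (child c t₀ t₁) point ≡⟨ sym (eval-node t₀ t₁ point (extends i ρi≡c)) ⟩
      eval (node i t₀ t₁) point  ∎ }
  where open RankCertificate C
        open ≡-Reasoning

freeQueryCertificate : ∀ (ρ : Restriction n) {i c} t₀ t₁ → ρ i ≡ nothing →
                       rank (child c t₀ t₁) < rank (node i t₀ t₁) →
                       RankCertificate (ρ [ i ↦ c ]) (child c t₀ t₁) → RankCertificate ρ (node i t₀ t₁)
freeQueryCertificate ρ {i} {c} t₀ t₁ ρi≡nothing rank-child< C = record
  { point = point ; support = ⁅ i ⁆ ∪ support ; extends = extends-↦⁻ ρ i ρi≡nothing extends
  ; small = ≤-trans (∣⁅x⁆∪p∣≤1+∣p∣ i support) (≤-trans (s≤s small) rank-child<)
  ; certifies = certifies′ }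
  where
  open RankCertificate C
  open ≡-Reasoning
  point-i : point i ≡ c
  point-i = extends i (updateAt-updates i ρ)
  certifies′ : ∀ x → Extends ρ x → AgreeOn (⁅ i ⁆ ∪ support) point x →
               eval (node i t₀ t₁) x ≡ eval (node i t₀ t₁) point
  certifies′ x x⊒ρ x≈point = begin
      eval (node i t₀ t₁) x      ≡⟨ eval-node t₀ t₁ x x-i ⟩
      eval (child c t₀ t₁) x     ≡⟨ certifies x (extends-↦⁺ ρ i x⊒ρ x-i)
                                      (λ j j∈S → x≈point j (x∈p∪q⁺ (inj₂ j∈S))) ⟩
      eval (child c t₀ t₁) point ≡⟨ sym (eval-node t₀ t₁ point point-i) ⟩
      eval (node i t₀ t₁) point  ∎
    where x-i : x i ≡ c
          x-i = trans (x≈point i (x∈p∪q⁺ (inj₁ (x∈⁅x⁆ i)))) point-i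

rankCertificate : (ρ : Restriction n) (T : DTree n) → RankCertificate ρ T
rankCertificate {n} ρ (leaf b) = record
  { point = fromMaybe false ∘ ρ ; support = ⊥ ; extends = extends-fromMaybe ρ
  ; small = ≤-reflexive (∣⊥∣≡0 n) ; certifies = λ _ _ _ → refl }
rankCertificate ρ (node i t₀ t₁) with ρ i in ρi | lowerRankChild i t₀ t₁
... | just false | _            = fixedQueryCertificate ρ t₀ t₁ ρi (rankCertificate ρ t₀)
... | just true  | _            = fixedQueryCertificate ρ t₀ t₁ ρi (rankCertificate ρ t₁)
... | nothing    | false , r₀< = freeQueryCertificate ρ t₀ t₁ ρi r₀< (rankCertificate (ρ [ i ↦ false ]) t₀)
... | nothing    | true  , r₁< = freeQueryCertificate ρ t₀ t₁ ρi r₁< (rankCertificate (ρ [ i ↦ true ]) t₁)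

certificate-respects-≗ : ∀ {f g : BoolFun n} {a S} → f ≗ g → IsCertificate f a S → IsCertificate g a S
certificate-respects-≗ {f = f} {g} {a} f≗g cert x x≈a = begin
  g x ≡⟨ sym (f≗g x) ⟩ f x ≡⟨ cert x x≈a ⟩ f a ≡⟨ f≗g a ⟩ g a ∎
  where open ≡-Reasoning

certificate≤rank : (f : BoolFun n) (T : DTree n) → Computes T f →
                   Σ (Input n) (λ a → Σ (Subset n) (λ S → IsCertificate f a S × ∣ S ∣ ≤ rank T))
certificate≤rank f T T-computes-f =
  point , support , certificate-respects-≗ T-computes-f (λ x → certifies x (λ _ ())) , small
  where open RankCertificate (rankCertificate (const nothing) T)

certificate-nonempty : ∀ {f : BoolFun n} {x y a S} → f x ≢ f y → IsCertificate f a S → Nonempty S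
certificate-nonempty {f = f} {x} {y} {a} {S} fx≢fy cert with nonempty? S
... | yes S≠∅ = S≠∅
... | no S=∅ = ⊥-elim (fx≢fy (trans (cert x vacuous) (sym (cert y vacuous))))
  where vacuous : ∀ {z} → AgreeOn S a z
        vacuous i i∈S = ⊥-elim (S=∅ (i , i∈S))

nonempty⇒0<∣p∣ : {p : Subset n} → Nonempty p → 0 < ∣ p ∣
nonempty⇒0<∣p∣ (x , x∈p) = ≤-trans (s≤s z≤n) (x∈p⇒∣p-x∣<∣p∣ x∈p)

relabel : (Fin m → Fin n) → DTree m → DTree n
relabel σ (leaf b)       = leaf b
relabel σ (node i t₀ t₁) = node (σ i) (relabel σ t₀) (relabel σ t₁)

eval-relabel : ∀ (σ : Fin m → Fin n) T x → eval (relabel σ T) x ≡ eval T (x ∘ σ)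
eval-relabel σ (leaf b)       x = refl
eval-relabel σ (node i t₀ t₁) x with x (σ i)
... | true  = eval-relabel σ t₁ x
... | false = eval-relabel σ t₀ x

rank-relabel : ∀ (σ : Fin m → Fin n) T → rank (relabel σ T) ≡ rank T
rank-relabel σ (leaf b)       = refl
rank-relabel σ (node i t₀ t₁) = cong₂ rankCombine (rank-relabel σ t₀) (rank-relabel σ t₁)

orTree : ∀ n → DTree n
orTree zero    = leaf false
orTree (suc n) = node zero (relabel suc (orTree n)) (leaf true)

orTree-computes : ∀ n → Computes (orTree n) (OR n)
orTree-computes zero    x = refl
orTree-computes (suc n) x with x zero
... | true  = refl
... | false = trans (eval-relabel suc (orTree n) x) (orTree-computes n (x ∘ suc))

rank-orTree : ∀ n → rank (orTree (suc n)) ≡ 1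
rank-orTree zero    = refl
rank-orTree (suc n) rewrite rank-relabel suc (orTree (suc n)) | rank-orTree n = refl

OR-false : ∀ n → OR n (const false) ≡ false
OR-false zero    = refl
OR-false (suc n) = OR-false n

OR-nonconstant : ∀ n → OR (suc n) (const true) ≢ OR (suc n) (const false)
OR-nonconstant n eq with () ← trans eq (OR-false n)

rank-orTree≤certificate : ∀ n (a : Input n) S → IsCertificate (OR n) a S → rank (orTree n) ≤ ∣ S ∣
rank-orTree≤certificate zero    a S cert = z≤n
rank-orTree≤certificate (suc n) a S cert = subst (_≤ ∣ S ∣) (sym (rank-orTree n))
  (nonempty⇒0<∣p∣ (certificate-nonempty {x = const true} {y = const false} (OR-nonconstant n) cert))

lemma5p7 : ((n : ℕ) (f : BoolFun n) (T : DTree n) → Computes T f →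
               Σ (Input n) (λ a → Σ (Subset n) (λ S → IsCertificate f a S × ∣ S ∣ ≤ rank T)))
             × ((n : ℕ) → Σ (DTree n) (λ T → Computes T (OR n) ×
               ((a : Input n) (S : Subset n) → IsCertificate (OR n) a S → rank T ≤ ∣ S ∣)))
lemma5p7 = (λ n → certificate≤rank)
         , λ n → orTree n , orTree-computes n , rank-orTree≤certificate n
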